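{- Let $H$ be a graph with $h$ vertices, and let $n,s,k$ be nonnegative integers with $0\leq s\leq n$. Then $\alpha_k(O_n\cup H)=0$ if $k<\chi(H)$ or $k>n+h$, and for $\chi(H)\leq k\leq n+h$, \[ \alpha_k(O_n\cup H)=\sum_{j=\chi(H)}^{k}{s+j \brace k}_{\!j}\,\alpha_j(O_{n-s}\cup H). \] In particular, for $s=n$, \[ \alpha_k(O_n\cup H)=\sum_{j=\chi(H)}^{k}{n+j \brace k}_{\!j}\,\alpha_j(H), \] and, for $s=1$, \[ \alpha_k(O_n\cup H)=k\,\alpha_k(O_{n-1}\cup H)+\alpha_{k-1}(O_{n-1}\cup H),\qquad n\geq 1. \]
   Context: All graphs are finite and simple. For a graph $G=(V,E)$ and an integer $k\ge 0$, $\alpha_k(G)$ denotes the number of partitions of $V$ into $k$ nonempty independent sets (so $\alpha_k(G)=0$ for $k$ outside $[\chi(G),|V|]$), where $\chi(G)$ is the chromatic number. $O_n$ ($n\ge1$) is the graph with $n$ vertices and no edges, and $O_0$ is the graph with no vertices. For graphs $G_1,G_2$ on disjoint vertex sets, $G_1\cup G_2$ is their disjoint union. The $r$-Stirling number of the second kind ${m \brace k}_{r}$ is the number of partitions of $\{1,\dots,m\}$ into $k$ nonempty blocks such that $1,2,\dots,r$ lie in distinct blocks. -}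

module Defs where

open import Data.Nat using (ℕ; zero; suc; _+_; _∸_; _<_; _≤_; _<ᵇ_)
import Data.Nat as ℕ
open import Data.Bool using (Bool; true; false; T; T?; _∧_; not)
open import Data.Fin using (Fin; toℕ; splitAt)
import Data.Fin as F
open import Data.Fin.Properties using (all?; any?)
import Data.Fin.Properties as FP
open import Data.List using (List; []; _∷_; map; concatMap; filter; length; upTo; allFin)
open import Data.Nat.ListAction using (sum)
open import Data.Vec.Functional using () renaming (_∷_ to _∷ᶠ_)
open import Data.Product using (Σ; ∃; _×_; _,_)
open import Data.Sum using (_⊎_; inj₁; inj₂)
open import Relation.Nullary using (Dec; ¬_; ¬?; does)
open import Relation.Nullary.Decidable using (_×-dec_; _→-dec_)
open import Relation.Binary.PropositionalEquality using (_≡_; _≢_; refl)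

record Graph (n : ℕ) : Set where
  field
    adj    : Fin n → Fin n → Bool
    sym    : ∀ u v → adj u v ≡ adj v u
    irrefl : ∀ v → adj v v ≡ false
open Graph public

O : (n : ℕ) → Graph n
O n = record { adj = λ _ _ → false ; sym = λ _ _ → refl ; irrefl = λ _ → refl }

-- Disjoint union: vertices of G₁ come first (Fin a), then those of G₂.
module _ {a b : ℕ} (G₁ : Graph a) (G₂ : Graph b) where
  adjSum : Fin a ⊎ Fin b → Fin a ⊎ Fin b → Bool
  adjSum (inj₁ u) (inj₁ v) = adj G₁ u v
  adjSum (inj₂ u) (inj₂ v) = adj G₂ u v
  adjSum (inj₁ _) (inj₂ _) = false
  adjSum (inj₂ _) (inj₁ _) = false

  adjSum-sym : ∀ x y → adjSum x y ≡ adjSum y x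
  adjSum-sym (inj₁ u) (inj₁ v) = sym G₁ u v
  adjSum-sym (inj₂ u) (inj₂ v) = sym G₂ u v
  adjSum-sym (inj₁ _) (inj₂ _) = refl
  adjSum-sym (inj₂ _) (inj₁ _) = refl

  adjSum-irr : ∀ x → adjSum x x ≡ false
  adjSum-irr (inj₁ u) = irrefl G₁ u
  adjSum-irr (inj₂ u) = irrefl G₂ u

  _∪ᴳ_ : Graph (a + b)
  _∪ᴳ_ = record
    { adj    = λ u v → adjSum (splitAt a u) (splitAt a v)
    ; sym    = λ u v → adjSum-sym (splitAt a u) (splitAt a v)
    ; irrefl = λ v → adjSum-irr (splitAt a v) }

-- Partitions of Fin m into k nonempty blocks, encoded canonically as
-- block-labellings c : Fin m → Fin k that are surjective (k nonempty
-- blocks) and where the blocks are numbered in increasing order of their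
-- least elements (each unordered partition has exactly one such labelling).

Separating : ∀ {m k} → (Fin m → Fin m → Bool) → (Fin m → Fin k) → Set
Separating sep c = ∀ u v → T (sep u v) → c u ≢ c v

Surjective : ∀ {m k} → (Fin m → Fin k) → Set
Surjective {m} {k} c = ∀ (j : Fin k) → ∃ λ v → c v ≡ j

Canonical : ∀ {m k} → (Fin m → Fin k) → Set
Canonical {m} c = ∀ v → 0 < toℕ (c v) →
  ∃ λ u → (u F.< v) × (suc (toℕ (c u)) ≡ toℕ (c v))

IsPartition : ∀ {m k} → (Fin m → Fin m → Bool) → (Fin m → Fin k) → Set
IsPartition sep c = Separating sep c × Surjective c × Canonical c

isPartition? : ∀ {m k} (sep : Fin m → Fin m → Bool) (c : Fin m → Fin k) →
  Dec (IsPartition sep c)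
isPartition? sep c =
  all? (λ u → all? (λ v → T? (sep u v) →-dec ¬? (c u F.≟ c v)))
  ×-dec all? (λ j → any? (λ v → c v F.≟ j))
  ×-dec all? (λ v → (0 ℕ.<? toℕ (c v)) →-dec
                    any? (λ u → (u F.<? v) ×-dec (suc (toℕ (c u)) ℕ.≟ toℕ (c v))))

allFuns : (m k : ℕ) → List (Fin m → Fin k)
allFuns zero    k = (λ ()) ∷ []
allFuns (suc m) k = concatMap (λ f → map (λ i → i ∷ᶠ f) (allFin k)) (allFuns m k)

countPartitions : (m k : ℕ) → (Fin m → Fin m → Bool) → ℕ
countPartitions m k sep = length (filter (isPartition? sep) (allFuns m k))

α : ∀ {n} → ℕ → Graph n → ℕ
α {n} k G = countPartitions n k (adj G)

-- r-Stirling number {m brace k}_r: elements 0..r-1 of Fin m (i.e. 1..r)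
-- lie in distinct blocks
rStirling : (m k r : ℕ) → ℕ
rStirling m k r = countPartitions m k
  (λ u v → (toℕ u <ᵇ r) ∧ (toℕ v <ᵇ r) ∧ not (does (u F.≟ v)))

ProperColouring : ∀ {n} → Graph n → (k : ℕ) → (Fin n → Fin k) → Set
ProperColouring G k f = Separating (adj G) f

IsChromaticNumber : ∀ {n} → Graph n → ℕ → Set
IsChromaticNumber {n} G c =
  (Σ (Fin n → Fin c) (ProperColouring G c)) ×
  (∀ k (f : Fin n → Fin k) → ProperColouring G k f → c ≤ k)

-- ∑_{j=a}^{b} f j  (empty if b < a)
sumFromTo : ℕ → ℕ → (ℕ → ℕ) → ℕ
sumFromTo a b f = sum (map (λ i → f (a + i)) (upTo (suc b ∸ a)))

-- The core is the Stirling recurrence for adding a vertex p that is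
-- separated from nothing (IsolatedVertex.partitions-step):
--   #partitions(m+1, k+1) = (k+1) · #partitions(m, k+1) + #partitions(m, k).
-- It is a direct count over the label of p for ordered partitions (surjective
-- labellings with arbitrarily numbered blocks), and transfers to partitions
-- since #ordered = k! · #canonical (BlockNumbering).  Applied to the first
-- vertex of O_{n+1} ∪ H it gives the recurrence for α (Union.α-step), applied
-- to the last of s+1+j elements the one for r-Stirling numbers (rStirling-step).
-- With the boundary values {j brace k}_j = [j = k], induction on s yields
--   α_k(O_{s+m} ∪ H) = ∑_{j ≤ k} {s+j brace k}_j α_j(O_m ∪ H)   (α-convolution),
-- and the terms j < χ(H) vanish because a partition restricts to a colouring
-- of H; the cases k < χ(H) and k > n + h vanish likewise and by pigeonhole.
module Submission where

open import Defs
open import Data.Nat using (ℕ; zero; suc; _+_; _*_; _∸_; _<_; _≤_; z≤n; s≤s; s≤s⁻¹; _≤?_; _<?_; _!; _<ᵇ_)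
import Data.Nat as ℕ
open import Data.Nat.Properties
open import Data.Fin as F using (Fin; zero; suc; toℕ; punchIn; punchOut; fromℕ<; fromℕ; splitAt; _↑ʳ_)
open import Data.Fin.Properties
  using ( punchInᵢ≢i; punchIn-injective; punchIn-punchOut; all?; any?; pigeonhole; splitAt-↑ʳ
        ; toℕ-injective; toℕ-inject₁; toℕ<n; toℕ-fromℕ<; toℕ-fromℕ; toℕ-inject≤)
  renaming (_≟_ to _≟ᶠ_; _<?_ to _<ᶠ?_)
open import Data.Fin.Permutation using (Permutation′; _⟨$⟩ʳ_; transpose)
import Data.Fin.Permutation.Components as PC
open import Data.Fin.Induction using (<-wellFounded)
open import Induction.WellFounded using (Acc; acc)
open import Data.Vec.Functional using (insertAt) renaming (_∷_ to _∷ᶠ_)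
open import Data.Vec.Functional.Properties using (insertAt-lookup; insertAt-punchIn)
open import Data.List using (List; []; _∷_; map; _++_; concatMap; filter; length; tabulate; allFin; applyUpTo)
open import Data.Nat.ListAction using (sum)
open import Data.Product using (Σ; ∃; _×_; _,_; proj₁; proj₂)
open import Data.Sum using (_⊎_; inj₁; inj₂; [_,_])
open import Data.Bool using (Bool; true; false; T; T?; _∧_; not; if_then_else_)
open import Data.Bool.Properties using (T-∧)
open import Data.Unit using (tt)
open import Function using (Equivalence)
open import Data.Nat.Tactic.RingSolver using (solve-∀)
open import Data.Empty using (⊥; ⊥-elim)
open import Relation.Nullary using (Dec; yes; no; ¬_; ¬?; does)
open import Relation.Nullary.Decidable using (_×-dec_; _→-dec_; dec-true; dec-false)
open import Relation.Unary using (Decidable)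
open import Relation.Binary using (tri<; tri≈; tri>)
open import Relation.Binary.PropositionalEquality
  using (_≡_; _≢_; refl; trans; cong; cong₂; subst; _≗_; module ≡-Reasoning)
import Relation.Binary.PropositionalEquality as ≡
open import Algebra.Properties.CommutativeSemigroup +-commutativeSemigroup using (interchange)
open import Algebra.Properties.Semiring.Sum +-*-semiring
  using (sum-cong-≗; sum-remove; *-distribʳ-sum; sum-permute; sum-replicate-zero; ∑-comm; ∑-distrib-+)
  renaming (sum to ∑)

does-cong : {A B : Set} (d : Dec A) (e : Dec B) → (A → B) → (B → A) → does d ≡ does e
does-cong (yes _) (yes _) _  _    = refl
does-cong (yes a) (no ¬b) to _    = ⊥-elim (¬b (to a))
does-cong (no ¬a) (yes b) _  from = ⊥-elim (¬a (from b))
does-cong (no _)  (no _)  _  _    = refl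

𝟙 : {A : Set} → Dec A → ℕ
𝟙 d = if does d then 1 else 0

𝟙-yes : {A : Set} (d : Dec A) → A → 𝟙 d ≡ 1
𝟙-yes d a = cong (λ b → if b then 1 else 0) (dec-true d a)

𝟙-no : {A : Set} (d : Dec A) → ¬ A → 𝟙 d ≡ 0
𝟙-no d ¬a = cong (λ b → if b then 1 else 0) (dec-false d ¬a)

𝟙-cong : {A B : Set} (d : Dec A) (e : Dec B) → (A → B) → (B → A) → 𝟙 d ≡ 𝟙 e
𝟙-cong d e to from = cong (λ b → if b then 1 else 0) (does-cong d e to from)

𝟙-split : {A B C D : Set} (a : Dec A) (b : Dec B) (c : Dec C) (d : Dec D) →
  (A → B ⊎ (C × D)) → (B ⊎ (C × D) → A) → (B → ¬ C) → 𝟙 a ≡ 𝟙 b + 𝟙 c * 𝟙 d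
𝟙-split a (yes b) (yes c) d to from excl = ⊥-elim (excl b c)
𝟙-split a (yes b) (no _)  d to from excl = 𝟙-yes a (from (inj₁ b))
𝟙-split a (no ¬b) (yes c) (yes d) to from excl = 𝟙-yes a (from (inj₂ (c , d)))
𝟙-split a (no ¬b) (yes _) (no ¬d) to from excl = 𝟙-no a (λ x → [ ¬b , (λ cd → ¬d (proj₂ cd)) ] (to x))
𝟙-split a (no ¬b) (no ¬c) d to from excl = 𝟙-no a (λ x → [ ¬b , (λ cd → ¬c (proj₁ cd)) ] (to x))

∑-single : ∀ {k} (g : Fin k → ℕ) (ℓ₀ : Fin k) → g ℓ₀ ≡ 1 → (∀ ℓ → ℓ ≢ ℓ₀ → g ℓ ≡ 0) → ∑ g ≡ 1
∑-single {suc k} g ℓ₀ g₁ g₀ = begin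
  ∑ g                                  ≡⟨ sum-remove {i = ℓ₀} g ⟩
  g ℓ₀ + ∑ (λ j → g (punchIn ℓ₀ j))    ≡⟨ cong₂ _+_ g₁ (sum-cong-≗ (λ j → g₀ _ (punchInᵢ≢i ℓ₀ j))) ⟩
  1 + ∑ {k} (λ _ → 0)                  ≡⟨ cong suc (sum-replicate-zero k) ⟩
  1                                    ∎
  where open ≡-Reasoning

∑-zero : ∀ {n} (g : Fin n → ℕ) → (∀ i → g i ≡ 0) → ∑ g ≡ 0
∑-zero {n} g z = trans (sum-cong-≗ z) (sum-replicate-zero n)

∑-const : ∀ n c → ∑ {n} (λ _ → c) ≡ n * c
∑-const zero    c = refl
∑-const (suc n) c = cong (c +_) (∑-const n c)

sumOver : {A : Set} → List A → (A → ℕ) → ℕ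
sumOver []       w = 0
sumOver (x ∷ xs) w = w x + sumOver xs w

sumOver-cong : {A : Set} (L : List A) {w w′ : A → ℕ} → w ≗ w′ → sumOver L w ≡ sumOver L w′
sumOver-cong []      eq = refl
sumOver-cong (x ∷ L) eq = cong₂ _+_ (eq x) (sumOver-cong L eq)

sumOver-++ : {A : Set} (L M : List A) (w : A → ℕ) → sumOver (L ++ M) w ≡ sumOver L w + sumOver M w
sumOver-++ []      M w = refl
sumOver-++ (x ∷ L) M w = trans (cong (w x +_) (sumOver-++ L M w)) (≡.sym (+-assoc (w x) _ _))

sumOver-map : {A B : Set} (g : A → B) (L : List A) (w : B → ℕ) → sumOver (map g L) w ≡ sumOver L (λ x → w (g x))
sumOver-map g []      w = refl
sumOver-map g (x ∷ L) w = cong (w (g x) +_) (sumOver-map g L w)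

sumOver-concatMap : {A B : Set} (F : A → List B) (L : List A) (w : B → ℕ) →
  sumOver (concatMap F L) w ≡ sumOver L (λ x → sumOver (F x) w)
sumOver-concatMap F []      w = refl
sumOver-concatMap F (x ∷ L) w =
  trans (sumOver-++ (F x) (concatMap F L) w) (cong (sumOver (F x) w +_) (sumOver-concatMap F L w))

sumOver-tabulate : ∀ {A : Set} n (f : Fin n → A) (w : A → ℕ) → sumOver (tabulate f) w ≡ ∑ (λ i → w (f i))
sumOver-tabulate zero    f w = refl
sumOver-tabulate (suc n) f w = cong (w (f zero) +_) (sumOver-tabulate n (λ i → f (suc i)) w)

sumOver-+ : {A : Set} (L : List A) (w w′ : A → ℕ) → sumOver L (λ x → w x + w′ x) ≡ sumOver L w + sumOver L w′
sumOver-+ []      w w′ = refl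
sumOver-+ (x ∷ L) w w′ =
  trans (cong (w x + w′ x +_) (sumOver-+ L w w′)) (interchange (w x) (w′ x) (sumOver L w) (sumOver L w′))

sumOver-zero : {A : Set} (L : List A) (w : A → ℕ) → (∀ x → w x ≡ 0) → sumOver L w ≡ 0
sumOver-zero []      w z = refl
sumOver-zero (x ∷ L) w z = trans (cong (_+ sumOver L w) (z x)) (sumOver-zero L w z)

sumOver-∑ : ∀ {A : Set} (L : List A) n (g : Fin n → A → ℕ) →
  sumOver L (λ x → ∑ (λ i → g i x)) ≡ ∑ (λ i → sumOver L (g i))
sumOver-∑ []      n g = ≡.sym (sum-replicate-zero n)
sumOver-∑ (x ∷ L) n g =
  trans (cong (∑ (λ i → g i x) +_) (sumOver-∑ L n g)) (≡.sym (∑-distrib-+ (λ i → g i x) (λ i → sumOver L (g i))))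

length-filter : {A : Set} {P : A → Set} (d : Decidable P) (L : List A) →
  length (filter d L) ≡ sumOver L (λ x → 𝟙 (d x))
length-filter d []      = refl
length-filter d (x ∷ L) with d x
... | yes _ = cong suc (length-filter d L)
... | no _  = length-filter d L

Labelling : ℕ → ℕ → Set
Labelling m k = Fin m → Fin k

count : (m k : ℕ) → (Labelling m k → ℕ) → ℕ
count m k w = sumOver (allFuns m k) w

Extensional : ∀ {m k} → (Labelling m k → ℕ) → Set
Extensional w = ∀ {c c′} → c ≗ c′ → w c ≡ w c′

count-cong : ∀ m k {w w′ : Labelling m k → ℕ} → w ≗ w′ → count m k w ≡ count m k w′
count-cong m k = sumOver-cong (allFuns m k)

count-none : ∀ m k {P : Labelling m k → Set} (d : Decidable P) → (∀ c → ¬ P c) →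
  count m k (λ c → 𝟙 (d c)) ≡ 0
count-none m k d none = sumOver-zero (allFuns m k) _ (λ c → 𝟙-no (d c) (none c))

∷-cong : ∀ {n} {A : Set} (i : A) {f g : Fin n → A} → f ≗ g → (i ∷ᶠ f) ≗ (i ∷ᶠ g)
∷-cong i eq zero    = refl
∷-cong i eq (suc x) = eq x

count-cons : ∀ m k (w : Labelling (suc m) k → ℕ) →
  count (suc m) k w ≡ ∑ (λ i → count m k (λ f → w (i ∷ᶠ f)))
count-cons m k w = begin
  sumOver (concatMap (λ f → map (λ i → i ∷ᶠ f) (allFin k)) (allFuns m k)) w
    ≡⟨ sumOver-concatMap _ (allFuns m k) w ⟩
  sumOver (allFuns m k) (λ f → sumOver (map (λ i → i ∷ᶠ f) (allFin k)) w)
    ≡⟨ sumOver-cong (allFuns m k) (λ f → trans (sumOver-map (λ i → i ∷ᶠ f) (allFin k) w)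
                                              (sumOver-tabulate k (λ i → i) (λ i → w (i ∷ᶠ f)))) ⟩
  sumOver (allFuns m k) (λ f → ∑ (λ i → w (i ∷ᶠ f)))
    ≡⟨ sumOver-∑ (allFuns m k) k (λ i f → w (i ∷ᶠ f)) ⟩
  ∑ (λ i → count m k (λ f → w (i ∷ᶠ f)))
    ∎
  where open ≡-Reasoning

insertAt-zero : ∀ {m} {A : Set} (f : Fin m → A) (i : A) → (i ∷ᶠ f) ≗ insertAt f zero i
insertAt-zero f i zero    = refl
insertAt-zero f i (suc x) = refl

insertAt-suc : ∀ {m} {A : Set} (f : Fin m → A) (p : Fin (suc m)) (i j : A) →
  (j ∷ᶠ insertAt f p i) ≗ insertAt (j ∷ᶠ f) (suc p) i
insertAt-suc f p i j zero    = refl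
insertAt-suc f p i j (suc x) = refl

count-insertAt : ∀ m k (p : Fin (suc m)) (w : Labelling (suc m) k → ℕ) → Extensional w →
  count (suc m) k w ≡ ∑ (λ i → count m k (λ f → w (insertAt f p i)))
count-insertAt m k zero w ext =
  trans (count-cons m k w) (sum-cong-≗ (λ i → count-cong m k (λ f → ext (insertAt-zero f i))))
count-insertAt (suc m) k (suc p) w ext = begin
  count (suc (suc m)) k w
    ≡⟨ count-cons (suc m) k w ⟩
  ∑ (λ j → count (suc m) k (λ g → w (j ∷ᶠ g)))
    ≡⟨ sum-cong-≗ (λ j → count-insertAt m k p (λ g → w (j ∷ᶠ g)) (λ eq → ext (∷-cong j eq))) ⟩
  ∑ (λ j → ∑ (λ i → count m k (λ f → w (j ∷ᶠ insertAt f p i))))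
    ≡⟨ ∑-comm (λ j i → count m k (λ f → w (j ∷ᶠ insertAt f p i))) ⟩
  ∑ (λ i → ∑ (λ j → count m k (λ f → w (j ∷ᶠ insertAt f p i))))
    ≡⟨ sum-cong-≗ (λ i → sum-cong-≗ (λ j → count-cong m k (λ f → ext (insertAt-suc f p i j)))) ⟩
  ∑ (λ i → ∑ (λ j → count m k (λ f → w (insertAt (j ∷ᶠ f) (suc p) i))))
    ≡⟨ sum-cong-≗ (λ i → ≡.sym (count-cons m k (λ g → w (insertAt g (suc p) i)))) ⟩
  ∑ (λ i → count (suc m) k (λ g → w (insertAt g (suc p) i)))
    ∎
  where open ≡-Reasoning

∘-∷ : ∀ {m} {A B : Set} (h : A → B) (i : A) (f : Fin m → A) →
  (λ x → h ((i ∷ᶠ f) x)) ≗ (h i ∷ᶠ (λ x → h (f x)))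
∘-∷ h i f zero    = refl
∘-∷ h i f (suc x) = refl

-- Relabelling by a permutation of the labels is a bijection on labellings.
count-relabel : ∀ m k (π : Permutation′ k) (w : Labelling m k → ℕ) → Extensional w →
  count m k (λ f → w (λ x → π ⟨$⟩ʳ f x)) ≡ count m k w
count-relabel zero    k π w ext = cong (_+ 0) (ext (λ ()))
count-relabel (suc m) k π w ext = begin
  count (suc m) k (λ f → w (λ x → π ⟨$⟩ʳ f x))
    ≡⟨ count-cons m k _ ⟩
  ∑ (λ i → count m k (λ f → w (λ x → π ⟨$⟩ʳ (i ∷ᶠ f) x)))
    ≡⟨ sum-cong-≗ (λ i → count-cong m k (λ f → ext (∘-∷ (π ⟨$⟩ʳ_) i f))) ⟩
  ∑ (λ i → count m k (λ f → w ((π ⟨$⟩ʳ i) ∷ᶠ (λ x → π ⟨$⟩ʳ f x))))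
    ≡⟨ sum-cong-≗ (λ i → count-relabel m k π (λ g → w ((π ⟨$⟩ʳ i) ∷ᶠ g)) (λ eq → ext (∷-cong _ eq))) ⟩
  ∑ (λ i → count m k (λ f → w ((π ⟨$⟩ʳ i) ∷ᶠ f)))
    ≡⟨ ≡.sym (sum-permute (λ j → count m k (λ f → w (j ∷ᶠ f))) π) ⟩
  ∑ (λ j → count m k (λ f → w (j ∷ᶠ f)))
    ≡⟨ ≡.sym (count-cons m k w) ⟩
  count (suc m) k w
    ∎
  where open ≡-Reasoning

Avoids : ∀ {m k} → Fin k → Labelling m k → Set
Avoids i f = ∀ x → f x ≢ i

avoids? : ∀ {m k} (i : Fin k) (f : Labelling m k) → Dec (Avoids i f)
avoids? i f = all? (λ x → ¬? (f x ≟ᶠ i))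

-- Labellings avoiding the label i are exactly punchIn i ∘ g for g with one label fewer.
count-avoiding : ∀ m k (i : Fin (suc k)) (w : Labelling m (suc k) → ℕ) → Extensional w →
  count m (suc k) (λ f → 𝟙 (avoids? i f) * w f) ≡ count m k (λ g → w (λ x → punchIn i (g x)))
count-avoiding zero k i w ext = cong (_+ 0) empty
  where
  empty : ∀ {f : Labelling 0 (suc k)} {g : Labelling 0 k} → 𝟙 (avoids? i f) * w f ≡ w (λ x → punchIn i (g x))
  empty {f} = trans (cong (_* w f) (𝟙-yes (avoids? i f) (λ ()))) (trans (+-identityʳ _) (ext (λ ())))
count-avoiding (suc m) k i w ext = begin
  count (suc m) (suc k) (λ f → 𝟙 (avoids? i f) * w f)
    ≡⟨ count-cons m (suc k) _ ⟩
  ∑ G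
    ≡⟨ sum-remove {i = i} G ⟩
  G i + ∑ (λ j → G (punchIn i j))
    ≡⟨ cong₂ _+_ G-i (sum-cong-≗ G-punchIn) ⟩
  0 + ∑ (λ j → count m k (λ g → w (λ x → punchIn i ((j ∷ᶠ g) x))))
    ≡⟨ ≡.sym (count-cons m k _) ⟩
  count (suc m) k (λ g → w (λ x → punchIn i (g x)))
    ∎
  where
  open ≡-Reasoning
  G : Fin (suc k) → ℕ
  G j = count m (suc k) (λ f → 𝟙 (avoids? i (j ∷ᶠ f)) * w (j ∷ᶠ f))
  G-i : G i ≡ 0
  G-i = sumOver-zero (allFuns m (suc k)) _
          (λ f → cong (_* w (i ∷ᶠ f)) (𝟙-no (avoids? i (i ∷ᶠ f)) (λ av → av zero refl)))
  G-punchIn : ∀ j → G (punchIn i j) ≡ count m k (λ g → w (λ x → punchIn i ((j ∷ᶠ g) x)))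
  G-punchIn j = begin
    G (punchIn i j)
      ≡⟨ count-cong m (suc k) (λ f → cong (_* w (punchIn i j ∷ᶠ f))
           (𝟙-cong (avoids? i (punchIn i j ∷ᶠ f)) (avoids? i f) (λ av x → av (suc x))
                   (λ av → λ { zero → punchInᵢ≢i i j ; (suc x) → av x }))) ⟩
    count m (suc k) (λ f → 𝟙 (avoids? i f) * w (punchIn i j ∷ᶠ f))
      ≡⟨ count-avoiding m k i (λ f → w (punchIn i j ∷ᶠ f)) (λ eq → ext (∷-cong _ eq)) ⟩
    count m k (λ g → w (punchIn i j ∷ᶠ (λ x → punchIn i (g x))))
      ≡⟨ count-cong m k (λ g → ext (λ x → ≡.sym (∘-∷ (punchIn i) j g x))) ⟩
    count m k (λ g → w (λ x → punchIn i ((j ∷ᶠ g) x)))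
      ∎

_≗?_ : ∀ {m k} (f g : Labelling m k) → Dec (f ≗ g)
f ≗? g = all? (λ x → f x ≟ᶠ g x)

count-singleton : ∀ m k (g : Labelling m k) → count m k (λ f → 𝟙 (f ≗? g)) ≡ 1
count-singleton zero    k g = cong (_+ 0) (𝟙-yes ((λ ()) ≗? g) (λ ()))
count-singleton (suc m) k g = trans (count-cons m k _) (∑-single G (g zero) G-g₀ G-other)
  where
  G : Fin k → ℕ
  G j = count m k (λ f → 𝟙 ((j ∷ᶠ f) ≗? g))
  G-g₀ : G (g zero) ≡ 1
  G-g₀ = trans (count-cong m k (λ f → 𝟙-cong ((g zero ∷ᶠ f) ≗? g) (f ≗? (λ x → g (suc x)))
                                        (λ eq x → eq (suc x)) (λ eq → λ { zero → refl ; (suc x) → eq x })))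
               (count-singleton m k (λ x → g (suc x)))
  G-other : ∀ j → j ≢ g zero → G j ≡ 0
  G-other j j≢g₀ = count-none m k (λ f → (j ∷ᶠ f) ≗? g) (λ f eq → j≢g₀ (eq zero))

partitions-count : ∀ m k (sep : Fin m → Fin m → Bool) →
  countPartitions m k sep ≡ count m k (λ c → 𝟙 (isPartition? sep c))
partitions-count m k sep = length-filter (isPartition? sep) (allFuns m k)

no-partitions : ∀ m k (sep : Fin m → Fin m → Bool) → (∀ c → ¬ IsPartition sep c) → countPartitions m k sep ≡ 0
no-partitions m k sep none = trans (partitions-count m k sep) (count-none m k (isPartition? sep) none)

too-many-blocks : ∀ m k (sep : Fin m → Fin m → Bool) → m < k → countPartitions m k sep ≡ 0
too-many-blocks m k sep m<k = no-partitions m k sep no-surjection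
  where
  no-surjection : ∀ c → ¬ IsPartition sep c
  no-surjection c (_ , onto , _) with pigeonhole m<k (λ j → proj₁ (onto j))
  ... | i , i′ , i<i′ , same = <-irrefl (cong toℕ (trans (≡.sym (proj₂ (onto i)))
                                                    (trans (cong c same) (proj₂ (onto i′))))) i<i′

zero-blocks : ∀ m (sep : Fin (suc m) → Fin (suc m) → Bool) → countPartitions (suc m) 0 sep ≡ 0
zero-blocks m sep = no-partitions (suc m) 0 sep (λ c _ → fin0 (c zero))
  where
  fin0 : Fin 0 → ⊥
  fin0 ()

least : ∀ {n} {Q : Fin n → Set} → Decidable Q → (v : Fin n) → Q v →
  Σ (Fin n) λ v₀ → Q v₀ × (∀ u → u F.< v₀ → ¬ Q u)
least {suc n} {Q} Q? v qv with Q? zero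
... | yes q₀ = zero , q₀ , λ u ()
... | no ¬q₀ with v
...   | zero = ⊥-elim (¬q₀ qv)
...   | suc v′ with least {n} {λ x → Q (suc x)} (λ x → Q? (suc x)) v′ qv
...     | v₀ , q , minimal = suc v₀ , q , below
  where
  below : ∀ u → u F.< suc v₀ → ¬ Q u
  below zero    _          = ¬q₀
  below (suc u) (s≤s u<v₀) = minimal u u<v₀

transpose-fix : ∀ {k} {a b x : Fin k} → x ≢ a → x ≢ b → PC.transpose a b x ≡ x
transpose-fix {a = a} {b} {x} x≢a x≢b rewrite dec-false (x ≟ᶠ a) x≢a | dec-false (x ≟ᶠ b) x≢b = refl

transpose-a : ∀ {k} (a b : Fin k) → PC.transpose a b a ≡ b
transpose-a a b rewrite dec-true (a ≟ᶠ a) refl = refl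

module Transposition {k} {t : ℕ} {a b : Fin k} (t≤a : t ≤ toℕ a) (t≤b : t ≤ toℕ b) where

  τ : Fin k → Fin k
  τ = PC.transpose a b

  τ-below : ∀ x → toℕ x < t → τ x ≡ x
  τ-below x x<t = transpose-fix (λ { refl → <⇒≱ x<t t≤a }) (λ { refl → <⇒≱ x<t t≤b })

  τ-above⁻ : ∀ x → t ≤ toℕ (τ x) → t ≤ toℕ x
  τ-above⁻ x t≤τx with toℕ x <? t
  ... | yes x<t = ⊥-elim (<⇒≱ x<t (subst (λ y → t ≤ toℕ y) (τ-below x x<t) t≤τx))
  ... | no  x≮t = ≮⇒≥ x≮t

  τ-injective : ∀ x y → τ x ≡ τ y → x ≡ y
  τ-injective x y eq = trans (≡.sym (PC.transpose-inverse b a))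
                             (trans (cong (PC.transpose b a) eq) (PC.transpose-inverse b a))

  τ-surjective : ∀ y → τ (PC.transpose b a y) ≡ y
  τ-surjective y = PC.transpose-inverse a b

separating? : ∀ {m k} (sep : Fin m → Fin m → Bool) (c : Labelling m k) → Dec (Separating sep c)
separating? sep c = all? (λ u → all? (λ v → T? (sep u v) →-dec ¬? (c u ≟ᶠ c v)))

surjective? : ∀ {m k} (c : Labelling m k) → Dec (Surjective c)
surjective? c = all? (λ j → any? (λ v → c v ≟ᶠ j))

-- An ordered partition into k blocks: a surjective labelling separating sep
-- (blocks are numbered arbitrarily, unlike IsPartition).
OrderedPartition : ∀ {m k} → (Fin m → Fin m → Bool) → Labelling m k → Set
OrderedPartition sep c = Separating sep c × Surjective c

orderedPartition? : ∀ {m k} (sep : Fin m → Fin m → Bool) (c : Labelling m k) → Dec (OrderedPartition sep c)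
orderedPartition? sep c = separating? sep c ×-dec surjective? c

orderedPartitions : (m k : ℕ) → (Fin m → Fin m → Bool) → ℕ
orderedPartitions m k sep = count m k (λ c → 𝟙 (orderedPartition? sep c))

separating-resp : ∀ {m k} {sep : Fin m → Fin m → Bool} {c c′ : Labelling m k} →
  c ≗ c′ → Separating sep c → Separating sep c′
separating-resp eq sp u v s same = sp u v s (trans (eq u) (trans same (≡.sym (eq v))))

surjective-resp : ∀ {m k} {c c′ : Labelling m k} → c ≗ c′ → Surjective c → Surjective c′
surjective-resp eq onto j = proj₁ (onto j) , trans (≡.sym (eq _)) (proj₂ (onto j))

orderedPartition-resp : ∀ {m k} {sep : Fin m → Fin m → Bool} {c c′ : Labelling m k} →
  c ≗ c′ → OrderedPartition sep c → OrderedPartition sep c′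
orderedPartition-resp eq (sp , onto) = separating-resp eq sp , surjective-resp eq onto

𝟙-extensional : ∀ {m k} {P : Labelling m k → Set} (P? : Decidable P) →
  (∀ {c c′} → c ≗ c′ → P c → P c′) → Extensional (λ c → 𝟙 (P? c))
𝟙-extensional P? resp eq = 𝟙-cong (P? _) (P? _) (resp eq) (resp (λ x → ≡.sym (eq x)))

-- For t = 0 this is no condition; for t = k it says
-- that the blocks are numbered canonically (Canonical).
OrderedBelow : ∀ {m k} → ℕ → Labelling m k → Set
OrderedBelow {k = k} t c = ∀ v (i : Fin k) → toℕ i < t → i F.< c v → ∃ λ u → u F.< v × c u ≡ i

orderedBelow? : ∀ {m k} t (c : Labelling m k) → Dec (OrderedBelow t c)
orderedBelow? t c = all? (λ v → all? (λ i → (toℕ i <? t) →-dec ((i <ᶠ? c v) →-dec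
                      any? (λ u → (u <ᶠ? v) ×-dec (c u ≟ᶠ i)))))

orderedBelow-resp : ∀ {m k t} {c c′ : Labelling m k} → c ≗ c′ → OrderedBelow t c → OrderedBelow t c′
orderedBelow-resp {t = t} {c} {c′} eq ord v i i<t i<c′v
  with ord v i i<t (subst (i F.<_) (≡.sym (eq v)) i<c′v)
... | u , u<v , cu≡i = u , u<v , trans (≡.sym (eq u)) cu≡i

-- Canonical numbering: following predecessors, every smaller label occurs earlier.
canonical⇒orderedBelow : ∀ {m k} {c : Labelling m k} → Canonical c → OrderedBelow k c
canonical⇒orderedBelow {c = c} can v i _ i<cv = go v (<-wellFounded v) i<cv
  where
  go : ∀ v → Acc F._<_ v → i F.< c v → ∃ λ u → u F.< v × c u ≡ i
  go v (acc rs) i<cv with can v (≤-trans (s≤s z≤n) i<cv)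
  ... | u , u<v , suc-cu≡cv with i ≟ᶠ c u
  ...   | yes refl = u , u<v , refl
  ...   | no i≢cu with go u (rs u<v) i<cu
    where
    i<cu : i F.< c u
    i<cu = ≤∧≢⇒< (s≤s⁻¹ (subst (suc (toℕ i) ≤_) (≡.sym suc-cu≡cv) i<cv)) (λ eq → i≢cu (toℕ-injective eq))
  ...     | u′ , u′<u , cu′≡i = u′ , <-trans u′<u u<v , cu′≡i

predecessor : ∀ {k} (x : Fin k) → 0 < toℕ x → Σ (Fin k) λ i → suc (toℕ i) ≡ toℕ x
predecessor (suc j) _ = F.inject₁ j , cong suc (toℕ-inject₁ j)

orderedBelow⇒canonical : ∀ {m k} {c : Labelling m k} → OrderedBelow k c → Canonical c
orderedBelow⇒canonical {c = c} ord v 0<cv with predecessor (c v) 0<cv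
... | i , suc-i≡cv with ord v i (toℕ<n i) (≤-reflexive suc-i≡cv)
...   | u , u<v , cu≡i = u , u<v , trans (cong (λ y → suc (toℕ y)) cu≡i) suc-i≡cv

labels-from : ∀ k t → ∑ {k} (λ ℓ → 𝟙 (t ≤? toℕ ℓ)) ≡ k ∸ t
labels-from zero    t       = ≡.sym (0∸n≡0 t)
labels-from (suc k) zero    = cong suc (trans (sum-cong-≗ {k}
  (λ ℓ → 𝟙-cong (0 ≤? suc (toℕ ℓ)) (0 ≤? toℕ ℓ) (λ _ → z≤n) (λ _ → z≤n))) (labels-from k zero))
labels-from (suc k) (suc t) = trans (sum-cong-≗ {k}
  (λ ℓ → 𝟙-cong (suc t ≤? suc (toℕ ℓ)) (t ≤? toℕ ℓ) s≤s⁻¹ s≤s)) (labels-from k t)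

-- Numbering the blocks: every partition into k blocks arises from exactly k!
-- ordered partitions.  Ordered t interpolates between ordered partitions
-- (t = 0) and canonically numbered ones (t = k); passing from t to t + 1
-- divides the count by k ∸ t, the number of choices for the first label ≥ t.
module BlockNumbering {m k : ℕ} (sep : Fin m → Fin m → Bool) where

  Ordered : ℕ → Labelling m k → Set
  Ordered t c = OrderedPartition sep c × OrderedBelow t c

  ordered? : ∀ t c → Dec (Ordered t c)
  ordered? t c = orderedPartition? sep c ×-dec orderedBelow? t c

  FirstLarge : ℕ → Fin k → Labelling m k → Set
  FirstLarge t ℓ c = t ≤ toℕ ℓ × (∀ v → t ≤ toℕ (c v) → c v ≢ ℓ → ∃ λ u → u F.< v × c u ≡ ℓ)

  Split : ℕ → Fin k → Labelling m k → Set
  Split t ℓ c = Ordered t c × FirstLarge t ℓ c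

  split? : ∀ t ℓ c → Dec (Split t ℓ c)
  split? t ℓ c = ordered? t c ×-dec (t ≤? toℕ ℓ) ×-dec
    all? (λ v → (t ≤? toℕ (c v)) →-dec (¬? (c v ≟ᶠ ℓ) →-dec any? (λ u → (u <ᶠ? v) ×-dec (c u ≟ᶠ ℓ))))

  split-resp : ∀ {t ℓ c c′} → c ≗ c′ → Split t ℓ c → Split t ℓ c′
  split-resp eq ((op , ord) , t≤ℓ , first) = (orderedPartition-resp eq op , orderedBelow-resp eq ord) , t≤ℓ ,
    λ v t≤c′v c′v≢ℓ → let (u , u<v , cu≡ℓ) = first v (subst (λ y → _ ≤ toℕ y) (≡.sym (eq v)) t≤c′v)
                                                       (λ cv≡ℓ → c′v≢ℓ (trans (≡.sym (eq v)) cv≡ℓ))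
                      in u , u<v , trans (≡.sym (eq u)) cu≡ℓ

  ordered : ℕ → ℕ
  ordered t = count m k (λ c → 𝟙 (ordered? t c))

  split : ℕ → Fin k → ℕ
  split t ℓ = count m k (λ c → 𝟙 (split? t ℓ c))

  -- If label t exists, an ordered labelling has exactly one first label ≥ t:
  -- the label of the first vertex whose label is ≥ t.
  unique-first-large : ∀ t → t < k → ∀ c → 𝟙 (ordered? t c) ≡ ∑ (λ ℓ → 𝟙 (split? t ℓ c))
  unique-first-large t t<k c = by-cases (ordered? t c)
    where
    by-cases : Dec (Ordered t c) → 𝟙 (ordered? t c) ≡ ∑ (λ ℓ → 𝟙 (split? t ℓ c))
    by-cases (no ¬o) = trans (𝟙-no (ordered? t c) ¬o)
                             (≡.sym (∑-zero _ (λ ℓ → 𝟙-no (split? t ℓ c) (λ s → ¬o (proj₁ s)))))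
    by-cases (yes o) with proj₂ (proj₁ o) (fromℕ< t<k)
    ... | v , cv≡t′
      with least (λ v → t ≤? toℕ (c v)) v (≤-reflexive (≡.sym (trans (cong toℕ cv≡t′) (toℕ-fromℕ< t<k))))
    ... | v₀ , t≤cv₀ , minimal =
      trans (𝟙-yes (ordered? t c) o)
            (≡.sym (∑-single _ (c v₀) (𝟙-yes (split? t (c v₀) c) (o , t≤cv₀ , first))
                                      (λ ℓ ℓ≢ → 𝟙-no (split? t ℓ c) (not-first ℓ ℓ≢))))
      where
      first : ∀ v → t ≤ toℕ (c v) → c v ≢ c v₀ → ∃ λ u → u F.< v × c u ≡ c v₀
      first v t≤cv cv≢ = v₀ , ≤∧≢⇒< (≮⇒≥ (λ v<v₀ → minimal v v<v₀ t≤cv))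
                                      (λ eq → cv≢ (cong c (≡.sym (toℕ-injective eq)))) , refl
      not-first : ∀ ℓ → ℓ ≢ c v₀ → ¬ Split t ℓ c
      not-first ℓ ℓ≢ (_ , t≤ℓ , firstℓ) with firstℓ v₀ t≤cv₀ (λ eq → ℓ≢ (≡.sym eq))
      ... | u , u<v₀ , cu≡ℓ = minimal u u<v₀ (subst (λ y → t ≤ toℕ y) (≡.sym cu≡ℓ) t≤ℓ)

  split-transpose : ∀ {t a b} → t ≤ toℕ b → ∀ c → Split t a c → Split t b (λ x → PC.transpose a b (c x))
  split-transpose {t} {a} {b} t≤b c (((sp , onto) , ord) , t≤a , first) =
    ((sp′ , onto′) , ord′) , t≤b , first′
    where
    open Transposition t≤a t≤b
    sp′ : Separating sep (λ x → τ (c x))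
    sp′ u v s eq = sp u v s (τ-injective _ _ eq)
    onto′ : Surjective (λ x → τ (c x))
    onto′ j = proj₁ (onto (PC.transpose b a j)) , trans (cong τ (proj₂ (onto _))) (τ-surjective j)
    below : ∀ v (i : Fin k) → toℕ i < t → i F.< τ (c v) → i F.< c v
    below v i i<t i<τcv with toℕ (c v) <? t
    ... | yes cv<t = subst (i F.<_) (τ-below (c v) cv<t) i<τcv
    ... | no  cv≮t = <-≤-trans i<t (≮⇒≥ cv≮t)
    ord′ : OrderedBelow t (λ x → τ (c x))
    ord′ v i i<t i<τcv with ord v i i<t (below v i i<t i<τcv)
    ... | u , u<v , cu≡i = u , u<v , trans (cong τ cu≡i) (τ-below i i<t)
    first′ : ∀ v → t ≤ toℕ (τ (c v)) → τ (c v) ≢ b → ∃ λ u → u F.< v × τ (c u) ≡ b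
    first′ v t≤τcv τcv≢b
      with first v (τ-above⁻ (c v) t≤τcv) (λ cv≡a → τcv≢b (trans (cong τ cv≡a) (transpose-a a b)))
    ... | u , u<v , cu≡a = u , u<v , trans (cong τ cu≡a) (transpose-a a b)

  split-shift : ∀ t (t′ ℓ : Fin k) → t ≤ toℕ t′ → t ≤ toℕ ℓ → split t ℓ ≡ split t t′
  split-shift t t′ ℓ t≤t′ t≤ℓ = begin
    count m k (λ c → 𝟙 (split? t ℓ c))
      ≡⟨ count-cong m k (λ c → 𝟙-cong (split? t ℓ c) (split? t t′ _) (split-transpose t≤t′ c) (back c)) ⟩
    count m k (λ c → 𝟙 (split? t t′ (λ x → PC.transpose ℓ t′ (c x))))
      ≡⟨ count-relabel m k (transpose ℓ t′) (λ c → 𝟙 (split? t t′ c)) (𝟙-extensional (split? t t′) split-resp) ⟩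
    count m k (λ c → 𝟙 (split? t t′ c))
      ∎
    where
    open ≡-Reasoning
    back : ∀ c → Split t t′ (λ x → PC.transpose ℓ t′ (c x)) → Split t ℓ c
    back c s = split-resp (λ x → PC.transpose-inverse t′ ℓ) (split-transpose t≤ℓ _ s)

  module Step (t : ℕ) (t<k : t < k) where

    t′ : Fin k
    t′ = fromℕ< t<k

    toℕ-t′ : toℕ t′ ≡ t
    toℕ-t′ = toℕ-fromℕ< t<k

    split⇒ordered : ∀ c → Split t t′ c → Ordered (suc t) c
    split⇒ordered c ((op , ord) , _ , first) = op , ord′
      where
      ord′ : OrderedBelow (suc t) c
      ord′ v i i<1+t i<cv with toℕ i <? t
      ... | yes i<t = ord v i i<t i<cv
      ... | no  i≮t with toℕ-injective {i = i} {t′} (trans (≤-antisym (s≤s⁻¹ i<1+t) (≮⇒≥ i≮t)) (≡.sym toℕ-t′))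
      ...   | refl = first v (<⇒≤ (subst (_< toℕ (c v)) toℕ-t′ i<cv))
                             (λ cv≡t′ → <-irrefl (cong toℕ (≡.sym cv≡t′)) i<cv)

    ordered⇒split : ∀ c → Ordered (suc t) c → Split t t′ c
    ordered⇒split c (op , ord) = (op , λ v i i<t → ord v i (m≤n⇒m≤1+n i<t)) , ≤-reflexive (≡.sym toℕ-t′) , first
      where
      first : ∀ v → t ≤ toℕ (c v) → c v ≢ t′ → ∃ λ u → u F.< v × c u ≡ t′
      first v t≤cv cv≢t′ = ord v t′ (s≤s (≤-reflexive toℕ-t′))
        (≤∧≢⇒< (subst (_≤ toℕ (c v)) (≡.sym toℕ-t′) t≤cv) (λ eq → cv≢t′ (≡.sym (toℕ-injective eq))))

    split-value : ∀ ℓ → split t ℓ ≡ 𝟙 (t ≤? toℕ ℓ) * ordered (suc t)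
    split-value ℓ = by-cases (t ≤? toℕ ℓ)
      where
      by-cases : Dec (t ≤ toℕ ℓ) → split t ℓ ≡ 𝟙 (t ≤? toℕ ℓ) * ordered (suc t)
      by-cases (yes t≤ℓ) = begin
        split t ℓ              ≡⟨ split-shift t t′ ℓ (≤-reflexive (≡.sym toℕ-t′)) t≤ℓ ⟩
        split t t′             ≡⟨ count-cong m k (λ c → 𝟙-cong (split? t t′ c) (ordered? (suc t) c)
                                                          (split⇒ordered c) (ordered⇒split c)) ⟩
        ordered (suc t)        ≡⟨ ≡.sym (*-identityˡ _) ⟩
        1 * ordered (suc t)    ≡⟨ cong (_* ordered (suc t)) (≡.sym (𝟙-yes (t ≤? toℕ ℓ) t≤ℓ)) ⟩
        𝟙 (t ≤? toℕ ℓ) * ordered (suc t)  ∎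
        where open ≡-Reasoning
      by-cases (no t≰ℓ) = trans (count-none m k (split? t ℓ) (λ c s → t≰ℓ (proj₁ (proj₂ s))))
                                (cong (_* ordered (suc t)) (≡.sym (𝟙-no (t ≤? toℕ ℓ) t≰ℓ)))

    ordered-step : ordered t ≡ (k ∸ t) * ordered (suc t)
    ordered-step = begin
      ordered t
        ≡⟨ count-cong m k (unique-first-large t t<k) ⟩
      count m k (λ c → ∑ (λ ℓ → 𝟙 (split? t ℓ c)))
        ≡⟨ sumOver-∑ (allFuns m k) k (λ ℓ c → 𝟙 (split? t ℓ c)) ⟩
      ∑ (λ ℓ → split t ℓ)
        ≡⟨ sum-cong-≗ split-value ⟩
      ∑ (λ (ℓ : Fin k) → 𝟙 (t ≤? toℕ ℓ) * ordered (suc t))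
        ≡⟨ ≡.sym (*-distribʳ-sum (ordered (suc t)) (λ (ℓ : Fin k) → 𝟙 (t ≤? toℕ ℓ))) ⟩
      ∑ (λ (ℓ : Fin k) → 𝟙 (t ≤? toℕ ℓ)) * ordered (suc t)
        ≡⟨ cong (_* ordered (suc t)) (labels-from k t) ⟩
      (k ∸ t) * ordered (suc t)
        ∎
      where open ≡-Reasoning

  ordered-zero : ordered 0 ≡ orderedPartitions m k sep
  ordered-zero = count-cong m k (λ c → 𝟙-cong (ordered? 0 c) (orderedPartition? sep c) proj₁
                                              (λ op → op , λ v i ()))

  ordered-top : ordered k ≡ countPartitions m k sep
  ordered-top = trans (count-cong m k (λ c → 𝟙-cong (ordered? k c) (isPartition? sep c) to from))
                      (≡.sym (partitions-count m k sep))
    where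
    to : ∀ {c} → Ordered k c → IsPartition sep c
    to ((sp , onto) , ord) = sp , onto , orderedBelow⇒canonical ord
    from : ∀ {c} → IsPartition sep c → Ordered k c
    from (sp , onto , can) = (sp , onto) , canonical⇒orderedBelow can

  ordered-descend : ∀ d t → t + d ≡ k → ordered t ≡ d ! * ordered k
  ordered-descend zero    t t+0≡k = trans (cong ordered (trans (≡.sym (+-identityʳ t)) t+0≡k)) (≡.sym (*-identityˡ _))
  ordered-descend (suc d) t t+d≡k = begin
    ordered t                        ≡⟨ Step.ordered-step t (subst (t <_) t+d≡k (m<m+n t (s≤s z≤n))) ⟩
    (k ∸ t) * ordered (suc t)        ≡⟨ cong₂ _*_ (trans (cong (_∸ t) (≡.sym t+d≡k)) (m+n∸m≡n t (suc d)))
                                                  (ordered-descend d (suc t) (trans (≡.sym (+-suc t d)) t+d≡k)) ⟩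
    suc d * (d ! * ordered k)        ≡⟨ ≡.sym (*-assoc (suc d) (d !) (ordered k)) ⟩
    suc d ! * ordered k              ∎
    where open ≡-Reasoning

  orderedPartitions≡k!*partitions : orderedPartitions m k sep ≡ k ! * countPartitions m k sep
  orderedPartitions≡k!*partitions =
    trans (≡.sym ordered-zero) (trans (ordered-descend k 0 refl) (cong (k ! *_) ordered-top))

-- In an ordered partition p carries any label i; removing p leaves either an
-- ordered partition into k+1 blocks or, if p was alone, one into the k labels ≠ i.
module IsolatedVertex {m : ℕ} (sep′ : Fin (suc m) → Fin (suc m) → Bool) (sep : Fin m → Fin m → Bool)
  (p : Fin (suc m)) (isolatedˡ : ∀ x → sep′ p x ≡ false) (isolatedʳ : ∀ x → sep′ x p ≡ false)
  (sep-rest : ∀ a b → sep′ (punchIn p a) (punchIn p b) ≡ sep a b) where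

  vertex-cases : ∀ x → x ≡ p ⊎ ∃ λ a → x ≡ punchIn p a
  vertex-cases x with p ≟ᶠ x
  ... | yes p≡x = inj₁ (≡.sym p≡x)
  ... | no  p≢x = inj₂ (punchOut p≢x , ≡.sym (punchIn-punchOut p≢x))

  module _ {k : ℕ} where

    SurjectiveExcept : Fin k → Labelling m k → Set
    SurjectiveExcept i f = ∀ j → j ≢ i → ∃ λ v → f v ≡ j

    OrderedPartitionExcept : Fin k → Labelling m k → Set
    OrderedPartitionExcept i f = Separating sep f × SurjectiveExcept i f

    orderedPartitionExcept? : ∀ (i : Fin k) (f : Labelling m k) → Dec (OrderedPartitionExcept i f)
    orderedPartitionExcept? i f = separating? sep f ×-dec all? (λ j → ¬? (j ≟ᶠ i) →-dec any? (λ v → f v ≟ᶠ j))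

    orderedPartitionExcept-resp : ∀ {i f f′} → f ≗ f′ → OrderedPartitionExcept i f → OrderedPartitionExcept i f′
    orderedPartitionExcept-resp eq (sp , onto) =
      separating-resp eq sp , λ j j≢i → proj₁ (onto j j≢i) , trans (≡.sym (eq _)) (proj₂ (onto j j≢i))

    separating-insert : ∀ (i : Fin k) (f : Labelling m k) → Separating sep′ (insertAt f p i) → Separating sep f
    separating-insert i f sp a b s eq = sp (punchIn p a) (punchIn p b) (subst T (≡.sym (sep-rest a b)) s)
      (trans (insertAt-punchIn f p i a) (trans eq (≡.sym (insertAt-punchIn f p i b))))

    separating-insert⁻ : ∀ (i : Fin k) (f : Labelling m k) → Separating sep f → Separating sep′ (insertAt f p i)
    separating-insert⁻ i f sp x y s with vertex-cases x | vertex-cases y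
    ... | inj₁ refl       | _               = ⊥-elim (subst T (isolatedˡ y) s)
    ... | inj₂ _          | inj₁ refl       = ⊥-elim (subst T (isolatedʳ x) s)
    ... | inj₂ (a , refl) | inj₂ (b , refl) = λ eq → sp a b (subst T (sep-rest a b) s)
      (trans (≡.sym (insertAt-punchIn f p i a)) (trans eq (insertAt-punchIn f p i b)))

    surjective-insert : ∀ (i : Fin k) (f : Labelling m k) →
      Surjective (insertAt f p i) → Surjective f ⊎ (Avoids i f × SurjectiveExcept i f)
    surjective-insert i f onto with any? (λ x → f x ≟ᶠ i)
    ... | yes (x , fx≡i) = inj₁ onto′
      where
      onto′ : Surjective f
      onto′ j with onto j
      ... | y , eq with vertex-cases y
      ...   | inj₁ refl       = x , trans fx≡i (trans (≡.sym (insertAt-lookup f p i)) eq)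
      ...   | inj₂ (a , refl) = a , trans (≡.sym (insertAt-punchIn f p i a)) eq
    ... | no ¬hit = inj₂ ((λ x fx≡i → ¬hit (x , fx≡i)) , onto′)
      where
      onto′ : SurjectiveExcept i f
      onto′ j j≢i with onto j
      ... | y , eq with vertex-cases y
      ...   | inj₁ refl       = ⊥-elim (j≢i (trans (≡.sym eq) (insertAt-lookup f p i)))
      ...   | inj₂ (a , refl) = a , trans (≡.sym (insertAt-punchIn f p i a)) eq

    surjective-insert⁻ : ∀ (i : Fin k) (f : Labelling m k) →
      Surjective f ⊎ (Avoids i f × SurjectiveExcept i f) → Surjective (insertAt f p i)
    surjective-insert⁻ i f (inj₁ onto) j = punchIn p (proj₁ (onto j)) , trans (insertAt-punchIn f p i _) (proj₂ (onto j))
    surjective-insert⁻ i f (inj₂ (_ , onto)) j with j ≟ᶠ i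
    ... | yes refl = p , insertAt-lookup f p i
    ... | no  j≢i  = punchIn p (proj₁ (onto j j≢i)) , trans (insertAt-punchIn f p i _) (proj₂ (onto j j≢i))

    orderedPartition-insert : ∀ (i : Fin k) (f : Labelling m k) → 𝟙 (orderedPartition? sep′ (insertAt f p i)) ≡
      𝟙 (orderedPartition? sep f) + 𝟙 (avoids? i f) * 𝟙 (orderedPartitionExcept? i f)
    orderedPartition-insert i f =
      𝟙-split (orderedPartition? sep′ (insertAt f p i)) (orderedPartition? sep f) (avoids? i f)
              (orderedPartitionExcept? i f) to from (λ (_ , onto) avoid → avoid _ (proj₂ (onto i)))
      where
      to : OrderedPartition sep′ (insertAt f p i) →
           OrderedPartition sep f ⊎ (Avoids i f × OrderedPartitionExcept i f)
      to (sp , onto) with surjective-insert i f onto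
      ... | inj₁ onto′          = inj₁ (separating-insert i f sp , onto′)
      ... | inj₂ (avoid , onto′) = inj₂ (avoid , separating-insert i f sp , onto′)
      from : OrderedPartition sep f ⊎ (Avoids i f × OrderedPartitionExcept i f) →
             OrderedPartition sep′ (insertAt f p i)
      from (inj₁ (sp , onto))          = separating-insert⁻ i f sp , surjective-insert⁻ i f (inj₁ onto)
      from (inj₂ (avoid , sp , onto)) = separating-insert⁻ i f sp , surjective-insert⁻ i f (inj₂ (avoid , onto))

  orderedPartitionExcept-punchIn : ∀ {k} (i : Fin (suc k)) (g : Labelling m k) →
    𝟙 (orderedPartitionExcept? i (λ x → punchIn i (g x))) ≡ 𝟙 (orderedPartition? sep g)
  orderedPartitionExcept-punchIn i g = 𝟙-cong (orderedPartitionExcept? i _) (orderedPartition? sep g) to from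
    where
    to : OrderedPartitionExcept i (λ x → punchIn i (g x)) → OrderedPartition sep g
    to (sp , onto) = (λ u v s eq → sp u v s (cong (punchIn i) eq))
                   , (λ j → proj₁ (onto (punchIn i j) (punchInᵢ≢i i j))
                          , punchIn-injective i _ _ (proj₂ (onto (punchIn i j) (punchInᵢ≢i i j))))
    from : OrderedPartition sep g → OrderedPartitionExcept i (λ x → punchIn i (g x))
    from (sp , onto) = (λ u v s eq → sp u v s (punchIn-injective i _ _ eq))
                     , λ j j≢i → let i≢j = λ eq → j≢i (≡.sym eq) in
                         proj₁ (onto (punchOut i≢j)) , trans (cong (punchIn i) (proj₂ (onto _))) (punchIn-punchOut i≢j)

  orderedPartitions-step : ∀ k → orderedPartitions (suc m) (suc k) sep′ ≡
    suc k * (orderedPartitions m (suc k) sep + orderedPartitions m k sep)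
  orderedPartitions-step k = begin
    orderedPartitions (suc m) (suc k) sep′
      ≡⟨ count-insertAt m (suc k) p _ (𝟙-extensional (orderedPartition? sep′) orderedPartition-resp) ⟩
    ∑ (λ i → count m (suc k) (λ f → 𝟙 (orderedPartition? sep′ (insertAt f p i))))
      ≡⟨ sum-cong-≗ each-label ⟩
    ∑ {suc k} (λ _ → orderedPartitions m (suc k) sep + orderedPartitions m k sep)
      ≡⟨ ∑-const (suc k) _ ⟩
    suc k * (orderedPartitions m (suc k) sep + orderedPartitions m k sep)
      ∎
    where
    open ≡-Reasoning
    each-label : ∀ i → count m (suc k) (λ f → 𝟙 (orderedPartition? sep′ (insertAt f p i))) ≡
                       orderedPartitions m (suc k) sep + orderedPartitions m k sep
    each-label i = begin
      count m (suc k) (λ f → 𝟙 (orderedPartition? sep′ (insertAt f p i)))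
        ≡⟨ count-cong m (suc k) (orderedPartition-insert i) ⟩
      count m (suc k) (λ f → 𝟙 (orderedPartition? sep f) + 𝟙 (avoids? i f) * 𝟙 (orderedPartitionExcept? i f))
        ≡⟨ sumOver-+ (allFuns m (suc k)) _ _ ⟩
      orderedPartitions m (suc k) sep + count m (suc k) (λ f → 𝟙 (avoids? i f) * 𝟙 (orderedPartitionExcept? i f))
        ≡⟨ cong (orderedPartitions m (suc k) sep +_)
             (trans (count-avoiding m k i _ (𝟙-extensional (orderedPartitionExcept? i) orderedPartitionExcept-resp))
                    (count-cong m k (orderedPartitionExcept-punchIn i))) ⟩
      orderedPartitions m (suc k) sep + orderedPartitions m k sep
        ∎

  -- Dividing by (k+1)! = (k+1) · k! gives the recurrence for partitions.
  partitions-step : ∀ k → countPartitions (suc m) (suc k) sep′ ≡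
    suc k * countPartitions m (suc k) sep + countPartitions m k sep
  partitions-step k = *-cancelˡ-≡ _ _ (suc k !) {{suc k !≢0}} (begin
    suc k ! * countPartitions (suc m) (suc k) sep′
      ≡⟨ ≡.sym (BlockNumbering.orderedPartitions≡k!*partitions sep′) ⟩
    orderedPartitions (suc m) (suc k) sep′
      ≡⟨ orderedPartitions-step k ⟩
    suc k * (orderedPartitions m (suc k) sep + orderedPartitions m k sep)
      ≡⟨ cong (suc k *_) (cong₂ _+_ (BlockNumbering.orderedPartitions≡k!*partitions sep)
                                    (BlockNumbering.orderedPartitions≡k!*partitions sep)) ⟩
    suc k * (suc k ! * countPartitions m (suc k) sep + k ! * countPartitions m k sep)
      ≡⟨ factorials k (k !) _ _ ⟩
    suc k ! * (suc k * countPartitions m (suc k) sep + countPartitions m k sep)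
      ∎)
    where
    open ≡-Reasoning
    factorials : ∀ a f x y → suc a * ((suc a * f) * x + f * y) ≡ (suc a * f) * (suc a * x + y)
    factorials = solve-∀

-- O_n ∪ H: the vertices of O_n come first and are isolated, those of H follow.
module Union {h : ℕ} (H : Graph h) where

  first-isolatedˡ : ∀ n x → adj (O (suc n) ∪ᴳ H) zero x ≡ false
  first-isolatedˡ n x with splitAt (suc n) x
  ... | inj₁ _ = refl
  ... | inj₂ _ = refl

  first-isolatedʳ : ∀ n x → adj (O (suc n) ∪ᴳ H) x zero ≡ false
  first-isolatedʳ n x with splitAt (suc n) x
  ... | inj₁ _ = refl
  ... | inj₂ _ = refl

  rest : ∀ n a b → adj (O (suc n) ∪ᴳ H) (suc a) (suc b) ≡ adj (O n ∪ᴳ H) a b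
  rest n a b with splitAt n a | splitAt n b
  ... | inj₁ _ | inj₁ _ = refl
  ... | inj₁ _ | inj₂ _ = refl
  ... | inj₂ _ | inj₁ _ = refl
  ... | inj₂ _ | inj₂ _ = refl

  induced : ∀ n u v → adj (O n ∪ᴳ H) (n ↑ʳ u) (n ↑ʳ v) ≡ adj H u v
  induced n u v rewrite splitAt-↑ʳ n h u | splitAt-↑ʳ n h v = refl

  α-step : ∀ n k → α (suc k) (O (suc n) ∪ᴳ H) ≡ suc k * α (suc k) (O n ∪ᴳ H) + α k (O n ∪ᴳ H)
  α-step n = IsolatedVertex.partitions-step (adj (O (suc n) ∪ᴳ H)) (adj (O n ∪ᴳ H)) zero
               (first-isolatedˡ n) (first-isolatedʳ n) (rest n)

  -- A partition into k independent sets restricts to a proper k-colouring of H.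
  α-below-χ : ∀ χH n k → IsChromaticNumber H χH → k < χH → α k (O n ∪ᴳ H) ≡ 0
  α-below-χ χH n k (_ , minimal) k<χH = no-partitions (n + h) k _ not-partition
    where
    not-partition : ∀ c → ¬ IsPartition (adj (O n ∪ᴳ H)) c
    not-partition c (sp , _) = <⇒≱ k<χH (minimal k (λ v → c (n ↑ʳ v))
      (λ u v uv → sp (n ↑ʳ u) (n ↑ʳ v) (subst T (≡.sym (induced n u v)) uv)))

-- distinctBelow r u v: u ≠ v are both among the first r elements, so that
-- rStirling m k r = countPartitions m k (distinctBelow r).
distinctBelow : ∀ {m} → ℕ → Fin m → Fin m → Bool
distinctBelow r u v = (toℕ u <ᵇ r) ∧ (toℕ v <ᵇ r) ∧ not (does (u ≟ᶠ v))

distinctBelow-intro : ∀ {m r} {u v : Fin m} → toℕ u < r → toℕ v < r → u ≢ v → T (distinctBelow r u v)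
distinctBelow-intro {u = u} {v} u<r v<r u≢v rewrite dec-false (u ≟ᶠ v) u≢v =
  Equivalence.from T-∧ (<⇒<ᵇ u<r , Equivalence.from T-∧ (<⇒<ᵇ v<r , tt))

distinctBelow-distinct : ∀ {m r} {u v : Fin m} → T (distinctBelow r u v) → u ≢ v
distinctBelow-distinct {r = r} {u = u} t refl rewrite dec-true (u ≟ᶠ u) refl =
  proj₂ (Equivalence.to (T-∧ {toℕ u <ᵇ r}) (proj₂ (Equivalence.to (T-∧ {toℕ u <ᵇ r}) t)))

toℕ-punchIn-last : ∀ {m} (a : Fin m) → toℕ (punchIn (fromℕ m) a) ≡ toℕ a
toℕ-punchIn-last zero    = refl
toℕ-punchIn-last (suc a) = cong suc (toℕ-punchIn-last a)

-- The r-Stirling recurrence: the last of s + 1 + j elements is free.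
rStirling-step : ∀ s j k →
  rStirling (suc s + j) (suc k) j ≡ suc k * rStirling (s + j) (suc k) j + rStirling (s + j) k j
rStirling-step s j = IsolatedVertex.partitions-step (distinctBelow j) (distinctBelow j) (fromℕ (s + j))
                       isolatedˡ isolatedʳ sep-rest
  where
  last-free : (toℕ (fromℕ (s + j)) <ᵇ j) ≡ false
  last-free with toℕ (fromℕ (s + j)) <ᵇ j in eq
  ... | false = refl
  ... | true  = ⊥-elim (<⇒≱ (<ᵇ⇒< _ j (subst T (≡.sym eq) tt))
                            (subst (j ≤_) (≡.sym (toℕ-fromℕ (s + j))) (m≤n+m j s)))
  isolatedˡ : ∀ x → distinctBelow j (fromℕ (s + j)) x ≡ false
  isolatedˡ x rewrite last-free = refl
  isolatedʳ : ∀ x → distinctBelow j x (fromℕ (s + j)) ≡ false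
  isolatedʳ x rewrite last-free with toℕ x <ᵇ j
  ... | false = refl
  ... | true  = refl
  sep-rest : ∀ a b →
    distinctBelow j (punchIn (fromℕ (s + j)) a) (punchIn (fromℕ (s + j)) b) ≡ distinctBelow j a b
  sep-rest a b rewrite toℕ-punchIn-last a | toℕ-punchIn-last b
    | does-cong (punchIn (fromℕ (s + j)) a ≟ᶠ punchIn (fromℕ (s + j)) b) (a ≟ᶠ b)
                (punchIn-injective _ a b) (cong (punchIn _)) = refl

-- The first j elements lie in distinct blocks, so at least j blocks are needed.
rStirling-small : ∀ s j k → k < j → rStirling (s + j) k j ≡ 0
rStirling-small s j k k<j = no-partitions (s + j) k _ not-partition
  where
  j≤s+j : j ≤ s + j
  j≤s+j = m≤n+m j s
  not-partition : ∀ c → ¬ IsPartition (distinctBelow j) c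
  not-partition c (sp , _) with pigeonhole k<j (λ x → c (F.inject≤ x j≤s+j))
  ... | i , i′ , i<i′ , same = sp (F.inject≤ i j≤s+j) (F.inject≤ i′ j≤s+j)
    (distinctBelow-intro (subst (_< j) (≡.sym (toℕ-inject≤ i j≤s+j)) (toℕ<n i))
                         (subst (_< j) (≡.sym (toℕ-inject≤ i′ j≤s+j)) (toℕ<n i′))
                         (λ eq → <-irrefl (trans (≡.sym (toℕ-inject≤ i j≤s+j))
                                                 (trans (cong toℕ eq) (toℕ-inject≤ i′ j≤s+j))) i<i′))
    same

canonical-label≤position : ∀ {m k} {c : Labelling m k} → Canonical c → ∀ v → toℕ (c v) ≤ toℕ v
canonical-label≤position {c = c} can v = go v (<-wellFounded v)
  where
  go : ∀ v → Acc F._<_ v → toℕ (c v) ≤ toℕ v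
  go v (acc rs) with toℕ (c v) in eq
  ... | zero  = z≤n
  ... | suc x with can v (subst (0 <_) (≡.sym eq) (s≤s z≤n))
  ...   | u , u<v , suc-cu≡cv =
    ≤-trans (s≤s (subst (_≤ toℕ u) (suc-injective (trans suc-cu≡cv eq)) (go u (rs u<v)))) u<v

only-identity : ∀ j (c : Labelling j j) → IsPartition (distinctBelow j) c → c ≗ (λ x → x)
only-identity j c (sp , _ , can) v = go v (<-wellFounded v)
  where
  injective : ∀ u v → c u ≡ c v → u ≡ v
  injective u v eq with u ≟ᶠ v
  ... | yes u≡v = u≡v
  ... | no  u≢v = ⊥-elim (sp u v (distinctBelow-intro (toℕ<n u) (toℕ<n v) u≢v) eq)
  -- a label below its position would be fixed (by induction), contradicting injectivity
  go : ∀ v → Acc F._<_ v → c v ≡ v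
  go v (acc rs) with toℕ (c v) <? toℕ v
  ... | yes cv<v = ⊥-elim (<-irrefl (cong toℕ (injective (c v) v (go (c v) (rs cv<v)))) cv<v)
  ... | no  cv≮v = toℕ-injective (≤-antisym (canonical-label≤position can v) (≮⇒≥ cv≮v))

identity-partition : ∀ j (c : Labelling j j) → c ≗ (λ x → x) → IsPartition (distinctBelow j) c
identity-partition j c c≗id = sp , (λ y → y , c≗id y) , can
  where
  sp : Separating (distinctBelow j) c
  sp u v uv eq = distinctBelow-distinct {r = j} uv (trans (≡.sym (c≗id u)) (trans eq (c≗id v)))
  can : Canonical c
  can zero    0<c0 = ⊥-elim (<-irrefl (≡.sym (cong toℕ (c≗id zero))) 0<c0)
  can (suc v) _    = F.inject₁ v , ≤-reflexive (cong suc (toℕ-inject₁ v))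
                   , trans (cong (λ y → suc (toℕ y)) (c≗id (F.inject₁ v)))
                           (trans (cong suc (toℕ-inject₁ v)) (≡.sym (cong toℕ (c≗id (suc v)))))

rStirling-diag : ∀ j → rStirling j j j ≡ 1
rStirling-diag j = begin
  rStirling j j j
    ≡⟨ partitions-count j j (distinctBelow j) ⟩
  count j j (λ c → 𝟙 (isPartition? (distinctBelow j) c))
    ≡⟨ count-cong j j (λ c → 𝟙-cong (isPartition? _ c) (c ≗? (λ x → x)) (only-identity j c) (identity-partition j c)) ⟩
  count j j (λ c → 𝟙 (c ≗? (λ x → x)))
    ≡⟨ count-singleton j j (λ x → x) ⟩
  1 ∎
  where open ≡-Reasoning

rStirling-base : ∀ j k → rStirling (0 + j) k j ≡ 𝟙 (j ℕ.≟ k)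
rStirling-base j k with <-cmp j k
... | tri< j<k j≢k _   = trans (too-many-blocks j k _ j<k) (≡.sym (𝟙-no (j ℕ.≟ k) j≢k))
... | tri≈ _   refl _  = trans (rStirling-diag j) (≡.sym (𝟙-yes (j ℕ.≟ j) refl))
... | tri> _   j≢k k<j = trans (rStirling-small 0 j k k<j) (≡.sym (𝟙-no (j ℕ.≟ k) j≢k))

sumBelow : ℕ → (ℕ → ℕ) → ℕ
sumBelow zero    g = 0
sumBelow (suc d) g = g 0 + sumBelow d (λ i → g (suc i))

sumBelow-cong : ∀ d {f g : ℕ → ℕ} → (∀ i → i < d → f i ≡ g i) → sumBelow d f ≡ sumBelow d g
sumBelow-cong zero    eq = refl
sumBelow-cong (suc d) eq = cong₂ _+_ (eq 0 (s≤s z≤n)) (sumBelow-cong d (λ i i<d → eq (suc i) (s≤s i<d)))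

sumBelow-zero : ∀ d (g : ℕ → ℕ) → (∀ i → i < d → g i ≡ 0) → sumBelow d g ≡ 0
sumBelow-zero zero    g z = refl
sumBelow-zero (suc d) g z =
  trans (cong (_+ sumBelow d (λ i → g (suc i))) (z 0 (s≤s z≤n))) (sumBelow-zero d _ (λ i i<d → z (suc i) (s≤s i<d)))

sumBelow-last : ∀ d g → sumBelow (suc d) g ≡ sumBelow d g + g d
sumBelow-last zero    g = +-comm (g 0) 0
sumBelow-last (suc d) g = trans (cong (g 0 +_) (sumBelow-last d (λ i → g (suc i)))) (≡.sym (+-assoc (g 0) _ _))

sumBelow-+ : ∀ d f g → sumBelow d (λ i → f i + g i) ≡ sumBelow d f + sumBelow d g
sumBelow-+ zero    f g = refl
sumBelow-+ (suc d) f g = trans (cong (f 0 + g 0 +_) (sumBelow-+ d (λ i → f (suc i)) (λ i → g (suc i))))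
                               (interchange (f 0) (g 0) _ _)

sumBelow-* : ∀ d c f → sumBelow d (λ i → c * f i) ≡ c * sumBelow d f
sumBelow-* zero    c f = ≡.sym (*-zeroʳ c)
sumBelow-* (suc d) c f = trans (cong (c * f 0 +_) (sumBelow-* d c (λ i → f (suc i)))) (≡.sym (*-distribˡ-+ c (f 0) _))

sumBelow-split : ∀ a d f → sumBelow (a + d) f ≡ sumBelow a f + sumBelow d (λ i → f (a + i))
sumBelow-split zero    d f = refl
sumBelow-split (suc a) d f = trans (cong (f 0 +_) (sumBelow-split a d (λ i → f (suc i)))) (≡.sym (+-assoc (f 0) _ _))

sumBelow-delta : ∀ k (g : ℕ → ℕ) → sumBelow (suc k) (λ j → 𝟙 (j ℕ.≟ k) * g j) ≡ g k
sumBelow-delta k g = begin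
  sumBelow (suc k) (λ j → 𝟙 (j ℕ.≟ k) * g j)               ≡⟨ sumBelow-last k _ ⟩
  sumBelow k (λ j → 𝟙 (j ℕ.≟ k) * g j) + 𝟙 (k ℕ.≟ k) * g k
    ≡⟨ cong₂ _+_ (sumBelow-zero k _ (λ i i<k → cong (_* g i) (𝟙-no (i ℕ.≟ k) (<⇒≢ i<k))))
                 (trans (cong (_* g k) (𝟙-yes (k ℕ.≟ k) refl)) (*-identityˡ (g k))) ⟩
  g k                                                        ∎
  where open ≡-Reasoning

sum-applyUpTo : ∀ d (h g : ℕ → ℕ) → sum (map g (applyUpTo h d)) ≡ sumBelow d (λ i → g (h i))
sum-applyUpTo zero    h g = refl
sum-applyUpTo (suc d) h g = cong (g (h 0) +_) (sum-applyUpTo d (λ i → h (suc i)) g)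

sumFromTo≡sumBelow : ∀ a b (f : ℕ → ℕ) → a ≤ suc b → (∀ i → i < a → f i ≡ 0) →
  sumFromTo a b f ≡ sumBelow (suc b) f
sumFromTo≡sumBelow a b f a≤1+b vanish = begin
  sumFromTo a b f
    ≡⟨ sum-applyUpTo (suc b ∸ a) (λ i → i) (λ i → f (a + i)) ⟩
  sumBelow (suc b ∸ a) (λ i → f (a + i))
    ≡⟨ cong (_+ sumBelow (suc b ∸ a) (λ i → f (a + i))) (≡.sym (sumBelow-zero a f vanish)) ⟩
  sumBelow a f + sumBelow (suc b ∸ a) (λ i → f (a + i))
    ≡⟨ ≡.sym (sumBelow-split a (suc b ∸ a) f) ⟩
  sumBelow (a + (suc b ∸ a)) f
    ≡⟨ cong (λ d → sumBelow d f) (m+[n∸m]≡n a≤1+b) ⟩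
  sumBelow (suc b) f
    ∎
  where open ≡-Reasoning

α-convolution : ∀ {h} (H : Graph h) s m k →
  α k (O (s + m) ∪ᴳ H) ≡ sumBelow (suc k) (λ j → rStirling (s + j) k j * α j (O m ∪ᴳ H))
α-convolution H zero m k = ≡.sym (begin
  sumBelow (suc k) (λ j → rStirling j k j * α j (O m ∪ᴳ H))
    ≡⟨ sumBelow-cong (suc k) (λ j _ → cong (_* α j (O m ∪ᴳ H)) (rStirling-base j k)) ⟩
  sumBelow (suc k) (λ j → 𝟙 (j ℕ.≟ k) * α j (O m ∪ᴳ H))
    ≡⟨ sumBelow-delta k (λ j → α j (O m ∪ᴳ H)) ⟩
  α k (O m ∪ᴳ H) ∎)
  where open ≡-Reasoning
α-convolution {h} H (suc s) m zero =
  trans (zero-blocks ((s + m) + h) _) (≡.sym (cong (λ r → r * α 0 (O m ∪ᴳ H) + 0) (zero-blocks (s + 0) _)))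
α-convolution H (suc s) m (suc k) = begin
  α (suc k) (O (suc (s + m)) ∪ᴳ H)
    ≡⟨ Union.α-step H (s + m) k ⟩
  suc k * α (suc k) (O (s + m) ∪ᴳ H) + α k (O (s + m) ∪ᴳ H)
    ≡⟨ cong₂ (λ a b → suc k * a + b) (α-convolution H s m (suc k)) (α-convolution H s m k) ⟩
  suc k * sumBelow (2 + k) A + sumBelow (suc k) B
    ≡⟨ cong (suc k * sumBelow (2 + k) A +_) B-extend ⟩
  suc k * sumBelow (2 + k) A + sumBelow (2 + k) B
    ≡⟨ cong (_+ sumBelow (2 + k) B) (≡.sym (sumBelow-* (2 + k) (suc k) A)) ⟩
  sumBelow (2 + k) (λ j → suc k * A j) + sumBelow (2 + k) B
    ≡⟨ ≡.sym (sumBelow-+ (2 + k) (λ j → suc k * A j) B) ⟩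
  sumBelow (2 + k) (λ j → suc k * A j + B j)
    ≡⟨ sumBelow-cong (2 + k) (λ j _ → termwise j) ⟩
  sumBelow (2 + k) (λ j → rStirling (suc s + j) (suc k) j * α j (O m ∪ᴳ H))
    ∎
  where
  open ≡-Reasoning
  A B : ℕ → ℕ
  A j = rStirling (s + j) (suc k) j * α j (O m ∪ᴳ H)
  B j = rStirling (s + j) k j * α j (O m ∪ᴳ H)
  -- the extra term j = k + 1 of B vanishes since k < k + 1 blocks are too few
  B-extend : sumBelow (suc k) B ≡ sumBelow (2 + k) B
  B-extend = ≡.sym (trans (sumBelow-last (suc k) B)
    (trans (cong (λ r → sumBelow (suc k) B + r * α (suc k) (O m ∪ᴳ H)) (rStirling-small s (suc k) k ≤-refl))
           (+-identityʳ _)))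
  collect : ∀ c r r₀ a → c * (r * a) + r₀ * a ≡ (c * r + r₀) * a
  collect = solve-∀
  termwise : ∀ j → suc k * A j + B j ≡ rStirling (suc s + j) (suc k) j * α j (O m ∪ᴳ H)
  termwise j = trans (collect (suc k) (rStirling (s + j) (suc k) j) (rStirling (s + j) k j) (α j (O m ∪ᴳ H)))
                     (cong (_* α j (O m ∪ᴳ H)) (≡.sym (rStirling-step s j k)))

-- Removing s of the n isolated vertices, and starting the sum at χ(H) since
-- α_j vanishes for j < χ(H).
α-reduction : ∀ {h} (H : Graph h) χH n s k → s ≤ n → IsChromaticNumber H χH → χH ≤ k →
  α k (O n ∪ᴳ H) ≡ sumFromTo χH k (λ j → rStirling (s + j) k j * α j (O (n ∸ s) ∪ᴳ H))
α-reduction H χH n s k s≤n isχ χH≤k = begin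
  α k (O n ∪ᴳ H)                  ≡⟨ cong (λ n′ → α k (O n′ ∪ᴳ H)) (≡.sym (m+[n∸m]≡n s≤n)) ⟩
  α k (O (s + (n ∸ s)) ∪ᴳ H)      ≡⟨ α-convolution H s (n ∸ s) k ⟩
  sumBelow (suc k) term           ≡⟨ ≡.sym (sumFromTo≡sumBelow χH k term (≤-trans χH≤k (n≤1+n k)) below-χ) ⟩
  sumFromTo χH k term             ∎
  where
  open ≡-Reasoning
  term : ℕ → ℕ
  term j = rStirling (s + j) k j * α j (O (n ∸ s) ∪ᴳ H)
  below-χ : ∀ j → j < χH → term j ≡ 0
  below-χ j j<χH =
    trans (cong (rStirling (s + j) k j *_) (Union.α-below-χ H χH (n ∸ s) j isχ j<χH)) (*-zeroʳ (rStirling (s + j) k j))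

theorem1 : ∀ {h : ℕ} (H : Graph h) (χH n s k : ℕ) → s ≤ n → IsChromaticNumber H χH →
    ((k < χH ⊎ n + h < k) → α k (O n ∪ᴳ H) ≡ 0)
    × (χH ≤ k → k ≤ n + h →
        α k (O n ∪ᴳ H) ≡ sumFromTo χH k (λ j → rStirling (s + j) k j * α j (O (n ∸ s) ∪ᴳ H)))
    × (χH ≤ k → k ≤ n + h →
        α k (O n ∪ᴳ H) ≡ sumFromTo χH k (λ j → rStirling (n + j) k j * α j H))
    × (∀ (n′ k′ : ℕ) → n ≡ suc n′ → k ≡ suc k′ → χH ≤ k → k ≤ n + h →
        α k (O n ∪ᴳ H) ≡ k * α k (O n′ ∪ᴳ H) + α k′ (O n′ ∪ᴳ H))
theorem1 {h} H χH n s k s≤n isχ =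
  vanishing , (λ χH≤k _ → α-reduction H χH n s k s≤n isχ χH≤k) , all-removed , one-removed
  where
  vanishing : (k < χH ⊎ n + h < k) → α k (O n ∪ᴳ H) ≡ 0
  vanishing (inj₁ k<χH)  = Union.α-below-χ H χH n k isχ k<χH
  vanishing (inj₂ n+h<k) = too-many-blocks (n + h) k _ n+h<k
  -- s = n: O_0 ∪ H is H itself
  all-removed : χH ≤ k → k ≤ n + h → α k (O n ∪ᴳ H) ≡ sumFromTo χH k (λ j → rStirling (n + j) k j * α j H)
  all-removed χH≤k _ = subst (λ r → α k (O n ∪ᴳ H) ≡ sumFromTo χH k (λ j → rStirling (n + j) k j * α j (O r ∪ᴳ H)))
                             (n∸n≡0 n) (α-reduction H χH n n k ≤-refl isχ χH≤k)
  -- s = 1 is the recurrence for α itself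
  one-removed : ∀ n′ k′ → n ≡ suc n′ → k ≡ suc k′ → χH ≤ k → k ≤ n + h →
    α k (O n ∪ᴳ H) ≡ k * α k (O n′ ∪ᴳ H) + α k′ (O n′ ∪ᴳ H)
  one-removed n′ k′ refl refl _ _ = Union.α-step H n′ k′
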